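{- Nesting is not expressible by a sparse powerset expression without using the $\nu$ operator itself: for a relation name $R$ of type $(0,0)$ there is no powerset algebra expression $e$ in which $\nu$ does not occur, whose natural evaluation strategy runs in polynomial space, such that $e(B)=\nu_2(R^B)$ for every database $B$ over $\{R\}$.
   Context: Relation types: $0$ is a type; if $\tau_1,\dots,\tau_k$ are types then $(\tau_1,\dots,\tau_k)$ is a type. Relations of type $0$ on $D$ are elements of $D$; relations of type $(\tau_1,\dots,\tau_k)$ on $D$ are finite sets of $k$-tuples whose $i$-th components are relations of type $\tau_i$. A database over a schema (finite set of relation names with types $\neq 0$) consists of a nonempty finite domain $D$ and a relation of the appropriate type for each name. Nested relational algebra operators: union, difference (same type), cartesian product, projection, equality selection (possibly set equality of nested components), nesting and unnesting. For $R$ of type $(\tau_1,\dots,\tau_k)$ and $i_1,\dots,i_p$, $\nu_{i_1,\dots,i_p}(R)$ is the set of tuples $(x_1,\dots,x_k,S)$ with $(x_1,\dots,x_k)\in R$ and $S=\{(y_{i_1},\dots,y_{i_p})\mid (y_1,\dots,y_k)\in R,\ y_j=x_j\ \forall j\notin\{i_1,\dots,i_p\}\}$; in particular for $R$ binary, $\nu_2(R)=\{(x,y,\{z\mid (x,z)\in R\})\mid (x,y)\in R\}$. Unnesting $\mu_i(R)=\{(x_1,\dots,x_k,y_1,\dots,y_\ell)\mid (x_1,\dots,x_k)\in R,\ (y_1,\dots,y_\ell)\in x_i\}$. Expressions are built from relation names and the symbol $D$ for the domain. The powerset algebra adds $\Pi(R)=\{S\mid S\subseteq R\}$. Natural evaluation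 strategy of a powerset algebra expression: for $e_1\Theta e_2$ with $\Theta$ binary, recursively evaluate $e_1,e_2$ into stored intermediate results and apply $\Theta$; for a unary operator $\theta(e)$ (including $\Pi$), recursively evaluate $e$ into an intermediate result and apply $\theta$. Space counted includes intermediate results and the final result, measured in the size of the input database. -}

module Defs where

open import Data.Nat using (ℕ; zero; suc; _+_; _*_; _^_; _≤_)
open import Data.Fin using (Fin; _≟_)
open import Data.Fin.Base using ()
open import Data.Bool using (Bool; true; false; _∧_; _∨_; not; if_then_else_)
open import Data.List using (List; []; _∷_; _++_; map; lookup; length; allFin; concatMap)
open import Data.Product using (Σ; _×_; ∃)
open import Data.Unit using (⊤)
open import Data.Empty using (⊥)
open import Relation.Nullary.Decidable using (⌊_⌋)
open import Relation.Binary.PropositionalEquality using (_≡_; subst; sym)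

-- Relation types.  `base` is type 0; `rel (τ₁ ∷ … ∷ τₖ ∷ [])` is the
-- type (τ₁,…,τₖ).

data Ty : Set where
  base : Ty
  rel  : List Ty → Ty

-- A finite set is represented by a list
-- of tuples (duplicates allowed; all notions below -- equality, size --
-- are invariant under duplication and reordering, i.e. set semantics).

mutual
  data Val (n : ℕ) : Ty → Set where
    atom : Fin n → Val n base
    set  : {ts : List Ty} → List (Tup n ts) → Val n (rel ts)

  data Tup (n : ℕ) : List Ty → Set where
    []  : Tup n []
    _∷_ : {t : Ty} {ts : List Ty} → Val n t → Tup n ts → Tup n (t ∷ ts)

mutual
  eqV : {n : ℕ} {t : Ty} → Val n t → Val n t → Bool
  eqV (atom a) (atom b) = ⌊ a ≟ b ⌋
  eqV (set xs) (set ys) = subL xs ys ∧ subL ys xs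

  eqT : {n : ℕ} {ts : List Ty} → Tup n ts → Tup n ts → Bool
  eqT [] [] = true
  eqT (x ∷ xs) (y ∷ ys) = eqV x y ∧ eqT xs ys

  memL : {n : ℕ} {ts : List Ty} → Tup n ts → List (Tup n ts) → Bool
  memL x [] = false
  memL x (y ∷ ys) = eqT x y ∨ memL x ys

  subL : {n : ℕ} {ts : List Ty} → List (Tup n ts) → List (Tup n ts) → Bool
  subL [] ys = true
  subL (x ∷ xs) ys = memL x ys ∧ subL xs ys

mutual
  sizeV : {n : ℕ} {t : Ty} → Val n t → ℕ
  sizeV (atom _) = 1
  sizeV (set xs) = suc (sizeL xs)

  sizeT : {n : ℕ} {ts : List Ty} → Tup n ts → ℕ
  sizeT [] = 0
  sizeT (x ∷ xs) = sizeV x + sizeT xs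

  sizeL : {n : ℕ} {ts : List Ty} → List (Tup n ts) → ℕ
  sizeL [] = 0
  sizeL (x ∷ xs) = (if memL x xs then 0 else sizeT x) + sizeL xs

lookupT : {n : ℕ} {ts : List Ty} → Tup n ts → (i : Fin (length ts)) → Val n (lookup ts i)
lookupT (x ∷ xs) Fin.zero = x
lookupT (x ∷ xs) (Fin.suc i) = lookupT xs i

appT : {n : ℕ} {ts us : List Ty} → Tup n ts → Tup n us → Tup n (ts ++ us)
appT [] ys = ys
appT (x ∷ xs) ys = x ∷ appT xs ys

projT : {n : ℕ} {ts : List Ty} → Tup n ts → (is : List (Fin (length ts))) → Tup n (map (lookup ts) is)
projT x [] = []
projT x (i ∷ is) = lookupT x i ∷ projT x is

filterB : {A : Set} → (A → Bool) → List A → List A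
filterB p [] = []
filterB p (x ∷ xs) = if p x then x ∷ filterB p xs else filterB p xs

memFin : {k : ℕ} → Fin k → List (Fin k) → Bool
memFin j [] = false
memFin j (i ∷ is) = ⌊ j ≟ i ⌋ ∨ memFin j is

elems : {n : ℕ} {us : List Ty} → Val n (rel us) → List (Tup n us)
elems (set ys) = ys

allB : {A : Set} → (A → Bool) → List A → Bool
allB p [] = true
allB p (x ∷ xs) = p x ∧ allB p xs

subsets : {A : Set} → List A → List (List A)
subsets [] = [] ∷ []
subsets (x ∷ xs) = subsets xs ++ map (x ∷_) (subsets xs)

record DB : Set where
  field
    m  : ℕ
    RB : List (Tup (suc m) (base ∷ base ∷ []))
open DB public

dom : DB → ℕ
dom B = suc (m B)

dbSize : DB → ℕ
dbSize B = dom B + sizeV (set (RB B))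

-- Powerset algebra expressions over {R}, indexed by the component list
-- ts of their (relation) type (τ₁,…,τₖ).

data Expr : List Ty → Set where
  R    : Expr (base ∷ base ∷ [])
  D    : Expr (base ∷ [])
  _∪_  : {ts : List Ty} → Expr ts → Expr ts → Expr ts
  _∖_  : {ts : List Ty} → Expr ts → Expr ts → Expr ts
  _⊗_  : {ts us : List Ty} → Expr ts → Expr us → Expr (ts ++ us)
  π    : {ts : List Ty} (i : Fin (length ts)) (is : List (Fin (length ts))) →
         Expr ts → Expr (map (lookup ts) (i ∷ is))
  σ    : {ts : List Ty} (i j : Fin (length ts)) → lookup ts i ≡ lookup ts j →
         Expr ts → Expr ts
  ν    : {ts : List Ty} (i : Fin (length ts)) (is : List (Fin (length ts))) →
         Expr ts → Expr (ts ++ rel (map (lookup ts) (i ∷ is)) ∷ [])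
  μ    : {ts us : List Ty} (i : Fin (length ts)) → lookup ts i ≡ rel us →
         Expr ts → Expr (ts ++ us)
  Π    : {ts : List Ty} → Expr ts → Expr (rel ts ∷ [])

⟦_⟧ : {ts : List Ty} → Expr ts → (B : DB) → List (Tup (dom B) ts)
⟦ R ⟧ B = RB B
⟦ D ⟧ B = map (λ a → atom a ∷ []) (allFin (dom B))
⟦ e₁ ∪ e₂ ⟧ B = ⟦ e₁ ⟧ B ++ ⟦ e₂ ⟧ B
⟦ e₁ ∖ e₂ ⟧ B = filterB (λ x → not (memL x (⟦ e₂ ⟧ B))) (⟦ e₁ ⟧ B)
⟦ e₁ ⊗ e₂ ⟧ B = concatMap (λ x → map (appT x) (⟦ e₂ ⟧ B)) (⟦ e₁ ⟧ B)
⟦ π i is e ⟧ B = map (λ x → projT x (i ∷ is)) (⟦ e ⟧ B)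
⟦ σ i j p e ⟧ B =
  filterB (λ x → eqV (lookupT x i) (subst (Val (dom B)) (sym p) (lookupT x j))) (⟦ e ⟧ B)
⟦ ν {ts} i is e ⟧ B =
  let xs = ⟦ e ⟧ B
      agree = λ x y → allB (λ j → memFin j (i ∷ is) ∨ eqV (lookupT x j) (lookupT y j))
                          (allFin (length ts))
  in map (λ x → appT x (set (map (λ y → projT y (i ∷ is)) (filterB (agree x) xs)) ∷ [])) xs
⟦ μ i p e ⟧ B =
  concatMap (λ x → map (appT x) (elems (subst (Val (dom B)) p (lookupT x i)))) (⟦ e ⟧ B)
⟦ Π e ⟧ B = map (λ s → set s ∷ []) (subsets (⟦ e ⟧ B))

NuFree : {ts : List Ty} → Expr ts → Set
NuFree R = ⊤
NuFree D = ⊤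
NuFree (e₁ ∪ e₂) = NuFree e₁ × NuFree e₂
NuFree (e₁ ∖ e₂) = NuFree e₁ × NuFree e₂
NuFree (e₁ ⊗ e₂) = NuFree e₁ × NuFree e₂
NuFree (π i is e) = NuFree e
NuFree (σ i j p e) = NuFree e
NuFree (ν i is e) = ⊥
NuFree (μ i p e) = NuFree e
NuFree (Π e) = NuFree e

-- Space used by the natural evaluation strategy: total size of all
-- intermediate results (one per subexpression) and the final result.
space : {ts : List Ty} → Expr ts → DB → ℕ
space e B = sizeV (set (⟦ e ⟧ B)) + sub e
  where
  sub : {us : List Ty} → Expr us → ℕ
  sub R = 0
  sub D = 0
  sub (e₁ ∪ e₂) = space e₁ B + space e₂ B
  sub (e₁ ∖ e₂) = space e₁ B + space e₂ B
  sub (e₁ ⊗ e₂) = space e₁ B + space e₂ B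
  sub (π i is e₁) = space e₁ B
  sub (σ i j p e₁) = space e₁ B
  sub (ν i is e₁) = space e₁ B
  sub (μ i p e₁) = space e₁ B
  sub (Π e₁) = space e₁ B

PolySpace : {ts : List Ty} → Expr ts → Set
PolySpace e = Σ ℕ λ c → Σ ℕ λ k → (B : DB) → space e B ≤ c * dbSize B ^ k

nu2 : Expr (base ∷ base ∷ rel (base ∷ []) ∷ [])
nu2 = ν (Fin.suc Fin.zero) [] R

_≈R_ : {n : ℕ} {ts : List Ty} → List (Tup n ts) → List (Tup n ts) → Set
xs ≈R ys = eqV (set xs) (set ys) ≡ true

{-# OPTIONS --safe #-}
-- On the database with domain D = {0,…,n} and R = {0} × D, the relation ν₂(R)
-- has D as a set-valued component.  In a ν-free expression every operator
-- except Π only copies sub-values of its inputs, so a set containing all of D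
-- must be created by some subexpression Π(e₁), and then ⟦e₁⟧ ⊇ D.  The
-- powerset of ⟦e₁⟧ has at least 2^(n+1) elements that differ as sets (already
-- on D), so evaluating Π(e₁) needs space 2^(n+1), while the database has size
-- at most 4(n+1).
module Submission where

open import Defs
open import Data.Bool using (Bool; true; false; if_then_else_)
open import Data.Bool.Properties using (∧-conicalˡ; ∧-conicalʳ; ⇔→≡)
open import Data.Empty using (⊥-elim)
open import Data.Fin as Fin using (Fin)
open import Data.Fin.Properties using (injective⇒≤)
open import Data.List using (List; []; _∷_; _++_; map; length; lookup; allFin; concatMap; replicate)
open import Data.List.Properties using (length-map; length-++; length-tabulate)
open import Data.List.Membership.Propositional using (_∈_; find)
open import Data.List.Membership.Propositional.Properties
  using (∈-map⁺; ∈-map⁻; ∈-++⁺ˡ; ∈-++⁺ʳ; ∈-++⁻; ∈-concatMap⁻; ∈-lookup; ∈-allFin)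
open import Data.List.Membership.Setoid.Properties using (index-injective)
open import Data.List.Relation.Binary.Disjoint.Propositional using (Disjoint)
open import Data.List.Relation.Binary.Subset.Propositional using (_⊆_)
import Data.List.Relation.Unary.All as All
open import Data.List.Relation.Unary.Any using (here; there; index)
open import Data.List.Relation.Unary.Unique.Propositional using (Unique; []; _∷_)
import Data.List.Relation.Unary.Unique.Propositional.Properties as Unique
open import Data.Nat using (ℕ; zero; suc; pred; _+_; _*_; _^_; _≤_; _<_; z≤n; s≤s)
open import Data.Nat.Properties
open import Data.Nat.Tactic.RingSolver using (solve-∀)
open import Data.Product using (Σ; _×_; _,_; proj₁; proj₂; ∃-syntax; map₁; map₂)
open import Data.Sum as Sum using (_⊎_; inj₁; inj₂; [_,_]′)
open import Data.Vec as Vec using (Vec)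
open import Data.Vec.Properties using (tabulate-cong; tabulate∘lookup; ∷-injectiveʳ)
open import Function using (id; _∘_; _⇔_; mk⇔; Equivalence)
open import Relation.Binary.PropositionalEquality
open import Relation.Nullary using (¬_; yes; no)

private variable
  n : ℕ
  t : Ty
  ts us : List Ty
  A C E : Set

∈-filterB⁻ : (p : A → Bool) (xs : List A) {x : A} → x ∈ filterB p xs → x ∈ xs × p x ≡ true
∈-filterB⁻ p (y ∷ xs) x∈ with p y in py | x∈
... | true  | here refl = here refl , py
... | true  | there x∈′ = map₁ there (∈-filterB⁻ p xs x∈′)
... | false | x∈′       = map₁ there (∈-filterB⁻ p xs x∈′)

∈-filterB⁺ : (p : A → Bool) {xs : List A} {x : A} → x ∈ xs → p x ≡ true → x ∈ filterB p xs
∈-filterB⁺ p {y ∷ _} (here refl) px rewrite px = here refl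
∈-filterB⁺ p {y ∷ _} (there x∈) px with p y
... | true  = there (∈-filterB⁺ p x∈ px)
... | false = ∈-filterB⁺ p x∈ px

∈-subsets⁻ : (xs : List A) {s : List A} → s ∈ subsets xs → s ⊆ xs
∈-subsets⁻ []       (here refl) ()
∈-subsets⁻ (y ∷ xs) s∈ x∈s with ∈-++⁻ (subsets xs) s∈
... | inj₁ s∈′ = there (∈-subsets⁻ xs s∈′ x∈s)
... | inj₂ s∈′ with ∈-map⁻ (y ∷_) s∈′ | x∈s
...   | _ , _   , refl | here refl = here refl
...   | _ , s′∈ , refl | there x∈s′ = there (∈-subsets⁻ xs s′∈ x∈s′)

filterB∈subsets : (p : A → Bool) (xs : List A) → filterB p xs ∈ subsets xs
filterB∈subsets p [] = here refl
filterB∈subsets p (y ∷ xs) with p y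
... | true  = ∈-++⁺ʳ (subsets xs) (∈-map⁺ (y ∷_) (filterB∈subsets p xs))
... | false = ∈-++⁺ˡ (filterB∈subsets p xs)

∈-concatMap-map⁻ : (f : A → List C) (g : A → C → E) (xs : List A) {z : E} →
                   z ∈ concatMap (λ x → map (g x) (f x)) xs →
                   ∃[ x ] ∃[ y ] x ∈ xs × y ∈ f x × z ≡ g x y
∈-concatMap-map⁻ f g xs z∈ with find (∈-concatMap⁻ (λ x → map (g x) (f x)) {xs = xs} z∈)
... | x , x∈ , z∈′ with ∈-map⁻ (g x) z∈′
...   | y , y∈ , refl = x , y , x∈ , y∈ , refl

lookup-injective : {xs : List A} → Unique xs → {i j : Fin (length xs)} → lookup xs i ≡ lookup xs j → i ≡ j
lookup-injective (_  ∷ _) {Fin.zero}  {Fin.zero}  _  = refl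
lookup-injective (x≢ ∷ _) {Fin.zero}  {Fin.suc j} eq = ⊥-elim (All.lookup x≢ (∈-lookup j) eq)
lookup-injective (x≢ ∷ _) {Fin.suc i} {Fin.zero}  eq = ⊥-elim (All.lookup x≢ (∈-lookup i) (sym eq))
lookup-injective (_  ∷ u) {Fin.suc i} {Fin.suc j} eq = cong Fin.suc (lookup-injective u eq)

unique⊆⇒length≤ : {xs ys : List A} → Unique xs → xs ⊆ ys → length xs ≤ length ys
unique⊆⇒length≤ {xs = xs} u xs⊆ys = injective⇒≤ {f = position} λ {i} {j} eq →
  lookup-injective u (index-injective (setoid _) (xs⊆ys (∈-lookup i)) (xs⊆ys (∈-lookup j)) eq)
  where
  position : Fin (length xs) → Fin _
  position i = index (xs⊆ys (∈-lookup i))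

memL⁻ : (x : Tup n ts) (xs : List (Tup n ts)) → memL x xs ≡ true → ∃[ y ] y ∈ xs × eqT x y ≡ true
memL⁻ x (y ∷ xs) x∈xs with eqT x y in x≈y
... | true  = y , here refl , x≈y
... | false = map₂ (map₁ there) (memL⁻ x xs x∈xs)

memL⁺ : (x : Tup n ts) {xs : List (Tup n ts)} {y : Tup n ts} → y ∈ xs → eqT x y ≡ true → memL x xs ≡ true
memL⁺ x {y ∷ _} (here refl) x≈y rewrite x≈y = refl
memL⁺ x {y ∷ _} (there y∈) x≈y with eqT x y
... | true  = refl
... | false = memL⁺ x y∈ x≈y

subL⁻ : (xs ys : List (Tup n ts)) → subL xs ys ≡ true → {x : Tup n ts} → x ∈ xs → memL x ys ≡ true
subL⁻ (x ∷ xs) ys xs⊑ys (here refl) = ∧-conicalˡ (memL x ys) _ xs⊑ys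
subL⁻ (x ∷ xs) ys xs⊑ys (there x∈) = subL⁻ xs ys (∧-conicalʳ (memL x ys) _ xs⊑ys) x∈

Unary : ℕ → Set
Unary n = Tup n (base ∷ [])

atomOf : Unary n → Fin n
atomOf (atom a ∷ []) = a

eqT-unary⇒≡ : (x y : Unary n) → eqT x y ≡ true → x ≡ y
eqT-unary⇒≡ (atom a ∷ []) (atom b ∷ []) x≈y with a Fin.≟ b
eqT-unary⇒≡ (atom a ∷ []) (atom b ∷ []) x≈y  | yes refl = refl
eqT-unary⇒≡ (atom a ∷ []) (atom b ∷ []) ()   | no _

eqT-unary-refl : (x : Unary n) → eqT x x ≡ true
eqT-unary-refl (atom a ∷ []) with a Fin.≟ a
... | yes _  = refl
... | no a≢a = ⊥-elim (a≢a refl)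

memL-unary : (x : Unary n) (s : List (Unary n)) → memL x s ≡ true ⇔ x ∈ s
memL-unary x s = mk⇔ from-memL (λ x∈ → memL⁺ x x∈ (eqT-unary-refl x))
  where
  from-memL : memL x s ≡ true → x ∈ s
  from-memL x∈s with memL⁻ x s x∈s
  ... | y , y∈ , x≈y = subst (_∈ s) (sym (eqT-unary⇒≡ x y x≈y)) y∈

subL-unary⇒⊆ : (s s′ : List (Unary n)) → subL s s′ ≡ true → s ⊆ s′
subL-unary⇒⊆ s s′ s⊑s′ {x} x∈ = Equivalence.to (memL-unary x s′) (subL⁻ s s′ s⊑s′ x∈)

Full : List (Unary n) → Set
Full {n} s = (a : Fin n) → atom a ∷ [] ∈ s

mutual
  data OccursV {n : ℕ} (s : List (Unary n)) : Val n t → Set where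
    self   : OccursV s (set s)
    within : {xs : List (Tup n ts)} {x : Tup n ts} → x ∈ xs → OccursT s x → OccursV s (set xs)

  data OccursT {n : ℕ} (s : List (Unary n)) : Tup n ts → Set where
    head : {v : Val n t} {vs : Tup n ts} → OccursV s v → OccursT s (v ∷ vs)
    tail : {v : Val n t} {vs : Tup n ts} → OccursT s vs → OccursT s (v ∷ vs)

FullOccurrence : List (Tup n ts) → Set
FullOccurrence {n} xs = ∃[ x ] ∃[ s ] x ∈ xs × OccursT {n} s x × Full s

¬occursT-atoms : (k : ℕ) (x : Tup n (replicate k base)) {s : List (Unary n)} → ¬ OccursT s x
¬occursT-atoms (suc k) (atom a ∷ x) (head ())
¬occursT-atoms (suc k) (atom a ∷ x) (tail o) = ¬occursT-atoms k x o

occursT-appT : (x : Tup n ts) {y : Tup n us} {s : List (Unary n)} →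
               OccursT s (appT x y) → OccursT s x ⊎ OccursT s y
occursT-appT []      o        = inj₂ o
occursT-appT (v ∷ x) (head o) = inj₁ (head o)
occursT-appT (v ∷ x) (tail o) = Sum.map₁ tail (occursT-appT x o)

occursT-lookupT : (x : Tup n ts) (i : Fin (length ts)) {s : List (Unary n)} →
                  OccursV s (lookupT x i) → OccursT s x
occursT-lookupT (v ∷ x) Fin.zero    o = head o
occursT-lookupT (v ∷ x) (Fin.suc i) o = tail (occursT-lookupT x i o)

occursT-projT : (x : Tup n ts) (is : List (Fin (length ts))) {s : List (Unary n)} →
                OccursT s (projT x is) → OccursT s x
occursT-projT x (i ∷ is) (head o) = occursT-lookupT x i o
occursT-projT x (i ∷ is) (tail o) = occursT-projT x is o

occursV-elems : (p : t ≡ rel us) (v : Val n t) {y : Tup n us} {s : List (Unary n)} →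
                y ∈ elems (subst (Val n) p v) → OccursT s y → OccursV s v
occursV-elems refl (set ys) y∈ o = within y∈ o

mutual
  occursV-eqV : {v w : Val n t} {s : List (Unary n)} → eqV v w ≡ true → OccursV s v →
                ∃[ s′ ] s ⊆ s′ × OccursV s′ w
  occursV-eqV {v = set s} {set s′} v≈w self =
    s′ , subL-unary⇒⊆ s s′ (∧-conicalˡ (subL s s′) _ v≈w) , self
  occursV-eqV {v = set xs} {set ys} v≈w (within x∈ o)
    with memL⁻ _ ys (subL⁻ xs ys (∧-conicalˡ (subL xs ys) _ v≈w) x∈)
  ... | y , y∈ , x≈y = map₂ (map₂ (within y∈)) (occursT-eqT x≈y o)

  occursT-eqT : {x y : Tup n ts} {s : List (Unary n)} → eqT x y ≡ true → OccursT s x →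
                ∃[ s′ ] s ⊆ s′ × OccursT s′ y
  occursT-eqT {x = v ∷ x} {w ∷ y} x≈y (head o) =
    map₂ (map₂ head) (occursV-eqV (∧-conicalˡ (eqV v w) _ x≈y) o)
  occursT-eqT {x = v ∷ x} {w ∷ y} x≈y (tail o) =
    map₂ (map₂ tail) (occursT-eqT (∧-conicalʳ (eqV v w) _ x≈y) o)

fullOccurrence-subL : (xs ys : List (Tup n ts)) → subL xs ys ≡ true → FullOccurrence xs → FullOccurrence ys
fullOccurrence-subL xs ys xs⊑ys (x , s , x∈ , o , full)
  with memL⁻ x ys (subL⁻ xs ys xs⊑ys x∈)
... | y , y∈ , x≈y with occursT-eqT x≈y o
...   | s′ , s⊆s′ , o′ = y , s′ , y∈ , o′ , s⊆s′ ∘ full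

-- Like sizeL, keeps only the last of several eqT-equal tuples.
distinct : List (Tup n ts) → List (Tup n ts)
distinct []       = []
distinct (x ∷ xs) = if memL x xs then distinct xs else x ∷ distinct xs

1≤sizeV : (v : Val n t) → 1 ≤ sizeV v
1≤sizeV (atom _) = s≤s z≤n
1≤sizeV (set _)  = s≤s z≤n

length-distinct≤sizeL : (xs : List (Tup n (t ∷ ts))) → length (distinct xs) ≤ sizeL xs
length-distinct≤sizeL []       = z≤n
length-distinct≤sizeL (x@(v ∷ _) ∷ xs) with memL x xs
... | true  = length-distinct≤sizeL xs
... | false = +-mono-≤ (m≤n⇒m≤n+o _ (1≤sizeV v)) (length-distinct≤sizeL xs)

map-⊆-distinct : (χ : Tup n ts → A) → (∀ x y → eqT x y ≡ true → χ x ≡ χ y) →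
                 (xs : List (Tup n ts)) → map χ xs ⊆ map χ (distinct xs)
map-⊆-distinct χ χ-resp (x ∷ xs) z∈ with memL x xs in x∈xs | z∈
... | true  | here refl with memL⁻ x xs x∈xs
...   | y , y∈ , x≈y =
  subst (_∈ map χ (distinct xs)) (sym (χ-resp x y x≈y)) (map-⊆-distinct χ χ-resp xs (∈-map⁺ χ y∈))
map-⊆-distinct χ χ-resp (x ∷ xs) z∈ | true  | there z∈′ = map-⊆-distinct χ χ-resp xs z∈′
map-⊆-distinct χ χ-resp (x ∷ xs) z∈ | false | here refl = here refl
map-⊆-distinct χ χ-resp (x ∷ xs) z∈ | false | there z∈′ = there (map-⊆-distinct χ χ-resp xs z∈′)

unique-image≤sizeL : (χ : Tup n (t ∷ ts) → A) → (∀ x y → eqT x y ≡ true → χ x ≡ χ y) →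
                     {vs : List A} → Unique vs → (xs : List (Tup n (t ∷ ts))) → vs ⊆ map χ xs →
                     length vs ≤ sizeL xs
unique-image≤sizeL χ χ-resp {vs} u xs vs⊆ = begin
  length vs                   ≤⟨ unique⊆⇒length≤ u (map-⊆-distinct χ χ-resp xs ∘ vs⊆) ⟩
  length (map χ (distinct xs)) ≡⟨ length-map χ (distinct xs) ⟩
  length (distinct xs)         ≤⟨ length-distinct≤sizeL xs ⟩
  sizeL xs                     ∎
  where open ≤-Reasoning

boolVecs : (k : ℕ) → List (Vec Bool k)
boolVecs zero    = Vec.[] ∷ []
boolVecs (suc k) = map (false Vec.∷_) (boolVecs k) ++ map (true Vec.∷_) (boolVecs k)

length-boolVecs : (k : ℕ) → length (boolVecs k) ≡ 2 ^ k
length-boolVecs zero    = refl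
length-boolVecs (suc k) = begin
  length (map (false Vec.∷_) (boolVecs k) ++ map (true Vec.∷_) (boolVecs k))
    ≡⟨ length-++ (map (false Vec.∷_) (boolVecs k)) ⟩
  length (map (false Vec.∷_) (boolVecs k)) + length (map (true Vec.∷_) (boolVecs k))
    ≡⟨ cong₂ _+_ (length-map _ (boolVecs k)) (length-map _ (boolVecs k)) ⟩
  length (boolVecs k) + length (boolVecs k)
    ≡⟨ cong₂ _+_ (length-boolVecs k) (trans (length-boolVecs k) (sym (+-identityʳ _))) ⟩
  2 ^ suc k ∎
  where open ≡-Reasoning

unique-boolVecs : (k : ℕ) → Unique (boolVecs k)
unique-boolVecs zero    = All.[] ∷ []
unique-boolVecs (suc k) =
  Unique.++⁺ (Unique.map⁺ ∷-injectiveʳ (unique-boolVecs k)) (Unique.map⁺ ∷-injectiveʳ (unique-boolVecs k)) disjoint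
  where
  disjoint : Disjoint (map (false Vec.∷_) (boolVecs k)) (map (true Vec.∷_) (boolVecs k))
  disjoint (f∈ , t∈) with ∈-map⁻ _ f∈ | ∈-map⁻ _ t∈
  ... | _ , _ , refl | _ , _ , ()

∈-boolVecs : {k : ℕ} (v : Vec Bool k) → v ∈ boolVecs k
∈-boolVecs Vec.[]          = here refl
∈-boolVecs (false Vec.∷ v) = ∈-++⁺ˡ (∈-map⁺ _ (∈-boolVecs v))
∈-boolVecs (true  Vec.∷ v) = ∈-++⁺ʳ _ (∈-map⁺ _ (∈-boolVecs v))

memL-unary-⊆ : {s s′ : List (Unary n)} (x : Unary n) → s ⊆ s′ → memL x s ≡ true → memL x s′ ≡ true
memL-unary-⊆ {s = s} {s′} x s⊆s′ =
  Equivalence.from (memL-unary x s′) ∘ s⊆s′ ∘ Equivalence.to (memL-unary x s)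

indicator : Tup n (rel (base ∷ []) ∷ []) → Vec Bool n
indicator (set s ∷ []) = Vec.tabulate λ a → memL (atom a ∷ []) s

indicator-eqT : (x y : Tup n (rel (base ∷ []) ∷ [])) → eqT x y ≡ true → indicator x ≡ indicator y
indicator-eqT (set s ∷ []) (set s′ ∷ []) x≈y = tabulate-cong λ a →
  ⇔→≡ (mk⇔ (memL-unary-⊆ (atom a ∷ []) s⊆s′) (memL-unary-⊆ (atom a ∷ []) s′⊆s))
  where
  s≈s′ = ∧-conicalˡ (eqV (set s) (set s′)) true x≈y
  s⊆s′ = subL-unary⇒⊆ s s′ (∧-conicalˡ (subL s s′) _ s≈s′)
  s′⊆s = subL-unary⇒⊆ s′ s (∧-conicalʳ (subL s s′) _ s≈s′)

indicator-filterB : {s : List (Unary n)} → Full s → (v : Vec Bool n) →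
                    indicator (set (filterB (Vec.lookup v ∘ atomOf) s) ∷ []) ≡ v
indicator-filterB {s = s} full v = trans (tabulate-cong λ a → ⇔→≡ (mk⇔ (into a) (outof a))) (tabulate∘lookup v)
  where
  p = Vec.lookup v ∘ atomOf
  into : (a : Fin _) → memL (atom a ∷ []) (filterB p s) ≡ true → Vec.lookup v a ≡ true
  into a = proj₂ ∘ ∈-filterB⁻ p s ∘ Equivalence.to (memL-unary _ _)
  outof : (a : Fin _) → Vec.lookup v a ≡ true → memL (atom a ∷ []) (filterB p s) ≡ true
  outof a = Equivalence.from (memL-unary _ _) ∘ ∈-filterB⁺ p (full a)

powerset : List (Tup n ts) → List (Tup n (rel ts ∷ []))
powerset xs = map (λ s → set s ∷ []) (subsets xs)

2^n≤sizeL-powerset : {s : List (Unary n)} → Full s → 2 ^ n ≤ sizeL (powerset s)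
2^n≤sizeL-powerset {n} {s} full = begin
  2 ^ n                 ≡⟨ length-boolVecs n ⟨
  length (boolVecs n)   ≤⟨ unique-image≤sizeL indicator indicator-eqT (unique-boolVecs n) _ realised ⟩
  sizeL (powerset s)    ∎
  where
  open ≤-Reasoning
  realised : boolVecs n ⊆ map indicator (powerset s)
  realised {v} _ = subst (_∈ map indicator (powerset s)) (indicator-filterB full v)
    (∈-map⁺ indicator (∈-map⁺ (λ s′ → set s′ ∷ []) (filterB∈subsets _ s)))

data _≺_ : Expr us → Expr ts → Set where
  ∪ˡ : {e₁ e₂ : Expr ts} → e₁ ≺ (e₁ ∪ e₂)
  ∪ʳ : {e₁ e₂ : Expr ts} → e₂ ≺ (e₁ ∪ e₂)
  ∖ˡ : {e₁ e₂ : Expr ts} → e₁ ≺ (e₁ ∖ e₂)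
  ∖ʳ : {e₁ e₂ : Expr ts} → e₂ ≺ (e₁ ∖ e₂)
  ⊗ˡ : {e₁ : Expr ts} {e₂ : Expr us} → e₁ ≺ (e₁ ⊗ e₂)
  ⊗ʳ : {e₁ : Expr ts} {e₂ : Expr us} → e₂ ≺ (e₁ ⊗ e₂)
  π≺ : {e : Expr ts} {i : Fin (length ts)} {is : List (Fin (length ts))} → e ≺ π i is e
  σ≺ : {e : Expr ts} {i j : Fin (length ts)} {p : lookup ts i ≡ lookup ts j} → e ≺ σ i j p e
  ν≺ : {e : Expr ts} {i : Fin (length ts)} {is : List (Fin (length ts))} → e ≺ ν i is e
  μ≺ : {e : Expr ts} {i : Fin (length ts)} {p : lookup ts i ≡ rel us} → e ≺ μ i p e
  Π≺ : {e : Expr ts} → e ≺ Π e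

space-≺ : (B : DB) (e : Expr ts) {e₁ : Expr us} → e₁ ≺ e → space e₁ B ≤ space e B
space-≺ B e ∪ˡ             = m≤n⇒m≤o+n (sizeV (set (⟦ e ⟧ B))) (m≤m+n _ _)
space-≺ B e (∪ʳ {e₁ = e₁}) = m≤n⇒m≤o+n (sizeV (set (⟦ e ⟧ B))) (m≤n+m _ (space e₁ B))
space-≺ B e ∖ˡ             = m≤n⇒m≤o+n (sizeV (set (⟦ e ⟧ B))) (m≤m+n _ _)
space-≺ B e (∖ʳ {e₁ = e₁}) = m≤n⇒m≤o+n (sizeV (set (⟦ e ⟧ B))) (m≤n+m _ (space e₁ B))
space-≺ B e ⊗ˡ             = m≤n⇒m≤o+n (sizeV (set (⟦ e ⟧ B))) (m≤m+n _ _)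
space-≺ B e (⊗ʳ {e₁ = e₁}) = m≤n⇒m≤o+n (sizeV (set (⟦ e ⟧ B))) (m≤n+m _ (space e₁ B))
space-≺ B e π≺             = m≤n+m _ (sizeV (set (⟦ e ⟧ B)))
space-≺ B e σ≺             = m≤n+m _ (sizeV (set (⟦ e ⟧ B)))
space-≺ B e ν≺             = m≤n+m _ (sizeV (set (⟦ e ⟧ B)))
space-≺ B e μ≺             = m≤n+m _ (sizeV (set (⟦ e ⟧ B)))
space-≺ B e Π≺             = m≤n+m _ (sizeV (set (⟦ e ⟧ B)))

2^dom≤space : (B : DB) (e : Expr ts) → NuFree e → {x : Tup (dom B) ts} {s : List (Unary (dom B))} →
              x ∈ ⟦ e ⟧ B → OccursT s x → Full s → 2 ^ dom B ≤ space e B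
2^dom≤space B R _ {x} _ o _ = ⊥-elim (¬occursT-atoms 2 x o)
2^dom≤space B D _ {x} _ o _ = ⊥-elim (¬occursT-atoms 1 x o)
2^dom≤space B e@(e₁ ∪ e₂) (nf₁ , nf₂) x∈ o full with ∈-++⁻ (⟦ e₁ ⟧ B) x∈
... | inj₁ x∈₁ = ≤-trans (2^dom≤space B e₁ nf₁ x∈₁ o full) (space-≺ B e ∪ˡ)
... | inj₂ x∈₂ = ≤-trans (2^dom≤space B e₂ nf₂ x∈₂ o full) (space-≺ B e ∪ʳ)
2^dom≤space B e@(e₁ ∖ e₂) (nf₁ , _) x∈ o full =
  ≤-trans (2^dom≤space B e₁ nf₁ (proj₁ (∈-filterB⁻ _ _ x∈)) o full) (space-≺ B e ∖ˡ)
2^dom≤space B e@(e₁ ⊗ e₂) (nf₁ , nf₂) x∈ o full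
  with ∈-concatMap-map⁻ (λ _ → ⟦ e₂ ⟧ B) appT (⟦ e₁ ⟧ B) x∈
... | x , y , x∈₁ , y∈₂ , refl with occursT-appT x o
...   | inj₁ o₁ = ≤-trans (2^dom≤space B e₁ nf₁ x∈₁ o₁ full) (space-≺ B e ⊗ˡ)
...   | inj₂ o₂ = ≤-trans (2^dom≤space B e₂ nf₂ y∈₂ o₂ full) (space-≺ B e ⊗ʳ)
2^dom≤space B e@(π i is e₁) nf x∈ o full with ∈-map⁻ _ x∈
... | x , x∈₁ , refl =
  ≤-trans (2^dom≤space B e₁ nf x∈₁ (occursT-projT x (i ∷ is) o) full) (space-≺ B e π≺)
2^dom≤space B e@(σ i j p e₁) nf x∈ o full =
  ≤-trans (2^dom≤space B e₁ nf (proj₁ (∈-filterB⁻ _ _ x∈)) o full) (space-≺ B e σ≺)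
2^dom≤space B (ν i is e₁) ()
2^dom≤space B e@(μ i p e₁) nf x∈ o full
  with ∈-concatMap-map⁻ (λ x → elems (subst (Val (dom B)) p (lookupT x i))) appT (⟦ e₁ ⟧ B) x∈
... | x , y , x∈₁ , y∈ , refl = ≤-trans (2^dom≤space B e₁ nf x∈₁ o₁ full) (space-≺ B e μ≺)
  where
  o₁ : OccursT _ x
  o₁ = [ id , occursT-lookupT x i ∘ occursV-elems p (lookupT x i) y∈ ]′ (occursT-appT x o)
2^dom≤space B e@(Π e₁) nf x∈ o full with ∈-map⁻ _ x∈
... | s , s∈ , refl with o
...   | head self = ≤-trans (2^n≤sizeL-powerset {s = ⟦ e₁ ⟧ B} (∈-subsets⁻ _ s∈ ∘ full))
                            (m≤n⇒m≤n+o (space e₁ B) (n≤1+n _))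
...   | head (within y∈s o₁) =
  ≤-trans (2^dom≤space B e₁ nf (∈-subsets⁻ _ s∈ y∈s) o₁ full) (space-≺ B e Π≺)

starDB : ℕ → DB
starDB n = record { m = n ; RB = map (λ z → atom Fin.zero ∷ atom z ∷ []) (allFin (suc n)) }

ν₂-collects : (B : DB) {a b : Fin (dom B)} → atom a ∷ atom b ∷ [] ∈ RB B →
              ∃[ S ] atom a ∷ atom b ∷ set S ∷ [] ∈ ⟦ nu2 ⟧ B ×
                     (∀ {c} → atom a ∷ atom c ∷ [] ∈ RB B → atom c ∷ [] ∈ S)
-- ν₂'s agreement test between (a,b) and (a,c) computes to the test a = a.
ν₂-collects B {a} ab∈ = _ , ∈-map⁺ _ ab∈ , λ ac∈ → ∈-map⁺ _ (∈-filterB⁺ _ ac∈ (eqT-unary-refl (atom a ∷ [])))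

fullOccurrence-ν₂-starDB : (n : ℕ) → FullOccurrence (⟦ nu2 ⟧ (starDB n))
fullOccurrence-ν₂-starDB n with ν₂-collects (starDB n) (here refl)
... | S , x∈ , collects = _ , S , x∈ , tail (tail (head self)) , λ c → collects (∈-map⁺ _ (∈-allFin c))

sizeL≤ : (b : ℕ) → (∀ x → sizeT x ≤ b) → (xs : List (Tup n ts)) → sizeL xs ≤ length xs * b
sizeL≤ b bound []       = z≤n
sizeL≤ b bound (x ∷ xs) = +-mono-≤ counted (sizeL≤ b bound xs)
  where
  counted : (if memL x xs then 0 else sizeT x) ≤ b
  counted with memL x xs
  ... | true  = z≤n
  ... | false = bound x

dbSize-starDB : (n : ℕ) → dbSize (starDB n) ≤ 4 * suc n
dbSize-starDB n = begin
  suc n + suc (sizeL (RB (starDB n)))         ≤⟨ +-monoʳ-≤ (suc n) (s≤s (sizeL≤ 2 pair-size (RB (starDB n)))) ⟩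
  suc n + suc (length (RB (starDB n)) * 2)    ≡⟨ cong (λ l → suc n + suc (l * 2)) length-RB ⟩
  suc n + suc (suc n * 2)                     ≤⟨ m≤m+n _ n ⟩
  suc n + suc (suc n * 2) + n                 ≡⟨ expand n ⟩
  4 * suc n                                   ∎
  where
  open ≤-Reasoning
  pair-size : (x : Tup (suc n) (base ∷ base ∷ [])) → sizeT x ≤ 2
  pair-size (atom _ ∷ atom _ ∷ []) = ≤-refl
  length-RB : length (RB (starDB n)) ≡ suc n
  length-RB = trans (length-map _ (allFin (suc n))) (length-tabulate id)
  expand : ∀ n → suc n + suc (suc n * 2) + n ≡ 4 * suc n
  expand = solve-∀

n<2^n : (n : ℕ) → n < 2 ^ n
n<2^n zero    = s≤s z≤n
n<2^n (suc n) = +-mono-≤ (m^n>0 2 n) (m≤n⇒m≤n+o 0 (n<2^n n))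

2^m≤2^n⇒m≤n : {m n : ℕ} → 2 ^ m ≤ 2 ^ n → m ≤ n
2^m≤2^n⇒m≤n 2^m≤2^n = ≮⇒≥ λ n<m → <⇒≱ (^-monoʳ-< 2 (s≤s (s≤s z≤n)) n<m) 2^m≤2^n

linear<2^ : (a b : ℕ) → ∃[ j ] a + b * j < 2 ^ j
linear<2^ a b = r + r , (begin-strict
  a + b * (r + r)           ≤⟨ +-monoˡ-≤ (b * (r + r)) (m≤m*n a r) ⟩
  a * r + b * (r + r)       ≤⟨ m≤n+m _ r ⟩
  r + (a * r + b * (r + r)) ≡⟨ expand a b ⟩
  r * r                     <⟨ *-mono-< (n<2^n r) (n<2^n r) ⟩
  2 ^ r * 2 ^ r             ≡⟨ ^-distribˡ-+-* 2 r r ⟨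
  2 ^ (r + r)               ∎)
  where
  open ≤-Reasoning
  r = suc (a + b + b)
  expand : ∀ a b → let r = suc (a + b + b) in r + (a * r + b * (r + r)) ≡ r * r
  expand = solve-∀

2^n-not-polynomially-bounded : (c k : ℕ) → ¬ (∀ n → 2 ^ suc n ≤ c * (4 * suc n) ^ k)
2^n-not-polynomially-bounded c k bound with linear<2^ (c + 2 * k) k
... | j , small = <⇒≱ small (begin
  2 ^ j             ≤⟨ 2^m≤2^n⇒m≤n 2^2^j≤2^poly ⟩
  c + (2 + j) * k   ≡⟨ expand c k j ⟩
  c + 2 * k + k * j ∎)
  where
  open ≤-Reasoning
  -- At n + 1 = 2 ^ j the polynomial bound is a power of 2 with exponent linear in j.
  N = 2 ^ j
  N≡1+pred = sym (suc-pred N {{m^n≢0 2 j}})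
  2^2^j≤2^poly : 2 ^ N ≤ 2 ^ (c + (2 + j) * k)
  2^2^j≤2^poly = begin
    2 ^ N                       ≡⟨ cong (2 ^_) N≡1+pred ⟩
    2 ^ suc (pred N)            ≤⟨ bound (pred N) ⟩
    c * (4 * suc (pred N)) ^ k  ≡⟨ cong (λ l → c * (4 * l) ^ k) N≡1+pred ⟨
    c * (4 * N) ^ k             ≡⟨ cong (λ l → c * l ^ k) (*-assoc 2 2 N) ⟩
    c * (2 ^ (2 + j)) ^ k       ≡⟨ cong (c *_) (^-*-assoc 2 (2 + j) k) ⟩
    c * 2 ^ ((2 + j) * k)       ≤⟨ *-monoˡ-≤ _ (<⇒≤ (n<2^n c)) ⟩
    2 ^ c * 2 ^ ((2 + j) * k)   ≡⟨ ^-distribˡ-+-* 2 c _ ⟨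
    2 ^ (c + (2 + j) * k)       ∎
  expand : ∀ c k j → c + (2 + j) * k ≡ c + 2 * k + k * j
  expand = solve-∀

proposition7p4 : ¬ (Σ (Expr (base ∷ base ∷ rel (base ∷ []) ∷ [])) λ e →
                      NuFree e × PolySpace e × ((B : DB) → ⟦ e ⟧ B ≈R ⟦ nu2 ⟧ B))
proposition7p4 (e , ν-free , (c , k , polySpace) , e≈ν₂) = 2^n-not-polynomially-bounded c k λ n →
  let B = starDB n
      ν₂⊑e = ∧-conicalʳ (subL (⟦ e ⟧ B) (⟦ nu2 ⟧ B)) _ (e≈ν₂ B)
      x , s , x∈ , o , full = fullOccurrence-subL _ _ ν₂⊑e (fullOccurrence-ν₂-starDB n)
  in begin
    2 ^ suc n           ≤⟨ 2^dom≤space B e ν-free x∈ o full ⟩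
    space e B           ≤⟨ polySpace B ⟩
    c * dbSize B ^ k    ≤⟨ *-monoʳ-≤ c (^-monoˡ-≤ k (dbSize-starDB n)) ⟩
    c * (4 * suc n) ^ k ∎
  where open ≤-Reasoning
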